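{- Let $G$ be a graph that is neither $K_1$ nor $2K_1$. Then $G\in\mathrm{BP2}$ if and only if one of the following holds: (a) $\bar G$ is disconnected; (b) $\bar G$ is connected and has a cut vertex; (c) $\bar G$ is connected and has a disconnected vertex cut.
   Context: All graphs are finite, simple and undirected. A biclique of a graph $G$ is a subgraph of $G$ isomorphic to $K_1$ or to $K_{m,n}$ for some $m,n\ge1$. BP2 is the set of graphs whose vertex set can be covered by at most two bicliques. $\bar G$ is the complement of $G$; $2K_1$ is the edgeless graph on two vertices. A cut vertex of a connected graph $H$ is a vertex $v$ with $H-v$ disconnected. A vertex cut of a connected graph $H$ is a set $X\subseteq V(H)$ with $H-X$ disconnected; it is a disconnected vertex cut if moreover $H[X]$ is disconnected. -}

module Defs where

open import Data.Nat using (ℕ)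
open import Data.Fin using (Fin)
open import Data.Bool using (Bool; true; false; not; _∧_; _∨_)
open import Data.Product using (Σ; ∃; ∃-syntax; _×_; _,_)
open import Data.Sum using (_⊎_)
open import Relation.Nullary using (¬_; does)
open import Relation.Binary.PropositionalEquality using (_≡_; _≢_)
open import Data.Fin using (_≟_)

record Graph (n : ℕ) : Set where
  field
    adj    : Fin n → Fin n → Bool
    sym    : ∀ u v → adj u v ≡ adj v u
    irrefl : ∀ v → adj v v ≡ false
open Graph public

VSet : ℕ → Set
VSet n = Fin n → Bool

full : ∀ {n} → VSet n
full _ = true

compl : ∀ {n} → VSet n → VSet n
compl X v = not (X v)

minus1 : ∀ {n} → Fin n → VSet n
minus1 v u = not (does (u ≟ v))

complement : ∀ {n} → Graph n → Graph n
complement {n} G = record { adj = a ; sym = s ; irrefl = i }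
  where
  open import Relation.Binary.PropositionalEquality using (refl; cong₂)
  open import Relation.Nullary using (yes; no)
  a : Fin n → Fin n → Bool
  a u v = not (does (u ≟ v)) ∧ not (adj G u v)
  eqsym : ∀ (u v : Fin n) → does (u ≟ v) ≡ does (v ≟ u)
  eqsym u v with u ≟ v | v ≟ u
  ... | yes _ | yes _ = refl
  ... | no _ | no _ = refl
  ... | yes refl | no ne = Data.Empty.⊥-elim (ne refl) where import Data.Empty
  ... | no ne | yes refl = Data.Empty.⊥-elim (ne refl) where import Data.Empty
  s : ∀ u v → a u v ≡ a v u
  s u v = cong₂ (λ x y → not x ∧ not y) (eqsym u v) (sym G u v)
  i : ∀ v → a v v ≡ false
  i v with v ≟ v
  ... | yes _ = refl
  ... | no ne = Data.Empty.⊥-elim (ne refl) where import Data.Empty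

-- A walk from u to v all of whose vertices lie in S
-- (i.e. a walk in the induced subgraph H[S]).
data WalkIn {n} (H : Graph n) (S : VSet n) : Fin n → Fin n → Set where
  here : ∀ {u} → S u ≡ true → WalkIn H S u u
  step : ∀ {u w v} → S u ≡ true → adj H u w ≡ true → WalkIn H S w v → WalkIn H S u v

ConnectedOn : ∀ {n} → Graph n → VSet n → Set
ConnectedOn H S =
  (∃[ v ] S v ≡ true) ×
  (∀ u v → S u ≡ true → S v ≡ true → WalkIn H S u v)

DisconnectedOn : ∀ {n} → Graph n → VSet n → Set
DisconnectedOn H S =
  ∃[ u ] ∃[ v ] (S u ≡ true × S v ≡ true × ¬ WalkIn H S u v)

Connected : ∀ {n} → Graph n → Set
Connected H = ConnectedOn H full

Disconnected : ∀ {n} → Graph n → Set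
Disconnected H = DisconnectedOn H full

IsCutVertex : ∀ {n} → Graph n → Fin n → Set
IsCutVertex H v = DisconnectedOn H (minus1 v)

HasCutVertex : ∀ {n} → Graph n → Set
HasCutVertex H = ∃[ v ] IsCutVertex H v

IsVertexCut : ∀ {n} → Graph n → VSet n → Set
IsVertexCut H X = DisconnectedOn H (compl X)

IsDisconnectedVertexCut : ∀ {n} → Graph n → VSet n → Set
IsDisconnectedVertexCut H X = IsVertexCut H X × DisconnectedOn H X

HasDisconnectedVertexCut : ∀ {n} → Graph n → Set
HasDisconnectedVertexCut H = ∃[ X ] IsDisconnectedVertexCut H X

-- S is the vertex set of a biclique of G, i.e. of a subgraph isomorphic to K₁
-- (S is a single vertex) or to K_{m,k} with m,k ≥ 1 (S is the union of two
-- disjoint nonempty sets A, B with every vertex of A adjacent in G to every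
-- vertex of B).
IsBicliqueVertexSet : ∀ {n} → Graph n → VSet n → Set
IsBicliqueVertexSet {n} G S =
  (Σ (Fin n) λ w → (∀ u → S u ≡ true → u ≡ w) × S w ≡ true)
  ⊎
  (Σ (VSet n) λ A → Σ (VSet n) λ B →
     ((Σ (Fin n) λ a → A a ≡ true) ×
      (Σ (Fin n) λ b → B b ≡ true) ×
      (∀ u → ¬ (A u ≡ true × B u ≡ true)) ×
      (∀ u → S u ≡ (A u ∨ B u)) ×
      (∀ a b → A a ≡ true → B b ≡ true → adj G a b ≡ true)))

-- BP2: V(G) can be covered by at most two bicliques
-- (one biclique is the case of two equal bicliques).
BP2 : ∀ {n} → Graph n → Set
BP2 {n} G =
  Σ (VSet n) λ S₁ → Σ (VSet n) λ S₂ →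
    (IsBicliqueVertexSet G S₁ × IsBicliqueVertexSet G S₂ ×
     (∀ v → S₁ v ≡ true ⊎ S₂ v ≡ true))

Edgeless : ∀ {n} → Graph n → Set
Edgeless G = ∀ u v → adj G u v ≡ false

module Submission where

-- Write Ḡ for the complement of G.  A biclique of G with at least two vertices
-- is a complete bipartite subgraph with sides L, R; in Ḡ no edge joins L to R.
-- This single observation drives both directions of the theorem.
--
-- (⇐) If Ḡ[S] is disconnected, then S is split by the component C of one vertex
--     into C and S ∖ C, and every G-non-edge between them would be a Ḡ-edge
--     leaving C; so S spans a biclique of G (`component-biclique`).  In the
--     three cases the covers are {V, V}, {V - v, {v}} and {X, V ∖ X}.
-- (⇒) If Ḡ is connected, no biclique spans V (`biclique-misses-vertex`).  A cover
--     {w} ∪ S gives the cut vertex w; two bicliques X₁, X₂ with sides L_i, R_i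
--     and vertices d ∈ R₁, b ∈ R₂, b ≠ d give the disconnected vertex cut X₂ - d;
--     if R₁ = R₂ = {d}, then d is universal in G, i.e. isolated in Ḡ, which is
--     impossible.  Two single vertices cover only K₁ or 2K₁.

open import Defs renaming (sym to adj-sym; irrefl to adj-irrefl)
open import Data.Nat using (ℕ; _≤_; zero; suc; s≤s; z≤n)
open import Data.Fin using (Fin; zero; suc; _≟_; _<_; fromℕ<)
open import Data.Fin.Properties using (any?; pigeonhole; <-irrefl; 0≢1+n)
open import Data.Fin.Subset using (Subset; _∈_; _∉_; _⊆_; _⊃_; _∪_; ⁅_⁆)
open import Data.Fin.Subset.Properties using (_∈?_; x∈⁅x⁆; x∈⁅y⁆⇒x≡y; p⊆p∪q; x∈p∪q⁻; x∈p∪q⁺)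
open import Data.Fin.Subset.Induction using (⊃-wellFounded)
open import Data.Bool using (true; false; not; _∧_; _∨_)
open import Data.Bool.Properties using (∨-comm; ∧-identityʳ; ∨-zeroʳ; ∧-zeroʳ) renaming (_≟_ to _≟ᵇ_)
open import Data.Product using (Σ-syntax; ∃-syntax; ∃₂; _×_; _,_; proj₁; proj₂)
open import Data.Sum using (_⊎_; inj₁; inj₂; [_,_]′; map) renaming (swap to ⊎-swap)
open import Data.Empty using (⊥; ⊥-elim)
open import Function using (_∘_; const)
open import Function.Bundles using (_⇔_; mk⇔)
open import Induction.WellFounded using (Acc; acc)
open import Relation.Nullary using (¬_; Dec; yes; no; does; ¬?; _×-dec_)
open import Relation.Nullary.Decidable using (dec-true; dec-false)
open import Relation.Binary.PropositionalEquality
  using (_≡_; _≢_; refl; sym; trans; cong; cong₂; subst; ≢-sym)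

clash : ∀ {x} → x ≡ true → x ≡ false → ⊥
clash refl ()

∧-true⁻ : ∀ x {y} → x ∧ y ≡ true → x ≡ true × y ≡ true
∧-true⁻ true p = refl , p

∨-true⁻ : ∀ x {y} → x ∨ y ≡ true → x ≡ true ⊎ y ≡ true
∨-true⁻ true  p = inj₁ refl
∨-true⁻ false p = inj₂ p

not-true : ∀ x → not x ≡ true → x ≡ false
not-true false _ = refl

absorb : ∀ s l → (l ≡ true → s ≡ true) → s ≡ (l ∨ (s ∧ not l))
absorb s     true  l⇒s = l⇒s refl
absorb s     false _   = sym (∧-identityʳ s)

does-true : ∀ {A : Set} (a? : Dec A) → does a? ≡ true → A
does-true (yes a) _ = a

does-false : ∀ {A : Set} (a? : Dec A) → not (does a?) ≡ true → ¬ A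
does-false (no ¬a) _ = ¬a

excluded : ∀ b → b ≡ true ⊎ not b ≡ true
excluded true  = inj₁ refl
excluded false = inj₂ refl

sole : ∀ {n} {R : VSet n} {d : Fin n} → ¬ (∃[ u ] (R u ≡ true × u ≢ d)) →
  ∀ {u} → R u ≡ true → u ≡ d
sole {d = d} none {u} ru with u ≟ d
... | yes u≡d = u≡d
... | no u≢d = ⊥-elim (none (u , ru , u≢d))

other : ∀ {n} {X₁ X₂ : VSet n} → (∀ v → X₁ v ≡ true ⊎ X₂ v ≡ true) →
  ∀ {v} → X₂ v ≡ false → X₁ v ≡ true
other cover {v} x₂v with cover v
... | inj₁ x₁v = x₁v
... | inj₂ x₂v′ = ⊥-elim (clash x₂v′ x₂v)

minus1⁻ : ∀ {n} {w u : Fin n} → minus1 w u ≡ true → u ≢ w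
minus1⁻ {w = w} {u} = does-false (u ≟ w)

minus1⁺ : ∀ {n} {w u : Fin n} → u ≢ w → minus1 w u ≡ true
minus1⁺ {w = w} {u} u≢w = cong not (dec-false (u ≟ w) u≢w)

_─_ : ∀ {n} → VSet n → Fin n → VSet n
(X ─ d) u = X u ∧ minus1 d u

∈─⁺ : ∀ {n} {X : VSet n} {d u} → X u ≡ true → u ≢ d → (X ─ d) u ≡ true
∈─⁺ xu u≢d rewrite xu = minus1⁺ u≢d

∉─⁺ : ∀ {n} {X : VSet n} {d u} → X u ≡ false → compl (X ─ d) u ≡ true
∉─⁺ xu rewrite xu = refl

removed : ∀ {n} {X : VSet n} d → compl (X ─ d) d ≡ true
removed {X = X} d with d ≟ d
... | yes _ = cong not (∧-zeroʳ (X d))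
... | no d≢d = ⊥-elim (d≢d refl)

∉─⁻ : ∀ {n} {X : VSet n} {d u} → compl (X ─ d) u ≡ true → X u ≡ false ⊎ u ≡ d
∉─⁻ {X = X} {d} {u} p with X u | u ≟ d
... | false | _ = inj₁ refl
... | true | yes u≡d = inj₂ u≡d
∉─⁻ () | true | no _

wfirst : ∀ {n} {H : Graph n} {S : VSet n} {u v} → WalkIn H S u v → S u ≡ true
wfirst (here s) = s
wfirst (step s _ _) = s

wlast : ∀ {n} {H : Graph n} {S : VSet n} {u v} → WalkIn H S u v → S v ≡ true
wlast (here s) = s
wlast (step _ _ p) = wlast p

snoc : ∀ {n} {H : Graph n} {S : VSet n} {u w v} →
  WalkIn H S u w → S v ≡ true → adj H w v ≡ true → WalkIn H S u v
snoc (here s) sv wv = step s wv (here sv)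
snoc (step s a p) sv wv = step s a (snoc p sv wv)

_++ʷ_ : ∀ {n} {H : Graph n} {S : VSet n} {u w v} →
  WalkIn H S u w → WalkIn H S w v → WalkIn H S u v
here _ ++ʷ q = q
step s a p ++ʷ q = step s a (p ++ʷ q)

reverse : ∀ {n} {H : Graph n} {S : VSet n} {u v} → WalkIn H S u v → WalkIn H S v u
reverse (here s) = here s
reverse {H = H} (step {u} {w} s a p) = snoc (reverse p) s (trans (adj-sym H w u) a)

-- Deciding reachability in an induced subgraph H[S]: grow the set of vertices
-- known to be reachable from u by one frontier vertex at a time.  This must stop
-- since the subsets of a finite set admit no infinite strictly increasing chain.

module Reachability {n} (H : Graph n) (S : VSet n) (u : Fin n) where

  Reached : Subset n → Set
  Reached R = ∀ {v} → v ∈ R → WalkIn H S u v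

  Closed : Subset n → Set
  Closed R = ∀ {w v} → w ∈ R → S v ≡ true → adj H w v ≡ true → v ∈ R

  Frontier : Subset n → Fin n → Set
  Frontier R v = S v ≡ true × v ∉ R × ∃[ w ] (w ∈ R × adj H w v ≡ true)

  frontier? : ∀ R v → Dec (Frontier R v)
  frontier? R v =
    (S v ≟ᵇ true) ×-dec ¬? (v ∈? R) ×-dec any? (λ w → (w ∈? R) ×-dec (adj H w v ≟ᵇ true))

  closure : ∀ R → Acc _⊃_ R → Reached R → Σ[ C ∈ Subset n ] (R ⊆ C × Reached C × Closed C)
  closure R (acc larger) reached with any? (frontier? R)
  ... | no none = R , (λ x → x) , reached , closed
    where
    closed : Closed R
    closed {w} {v} w∈R sv wv with v ∈? R
    ... | yes v∈R = v∈R
    ... | no v∉R = ⊥-elim (none (v , sv , v∉R , w , w∈R , wv))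
  ... | yes (v , sv , v∉R , w , w∈R , wv) with closure (R ∪ ⁅ v ⁆) (larger grown) reached′
    where
    grown : (R ∪ ⁅ v ⁆) ⊃ R
    grown = p⊆p∪q _ , v , x∈p∪q⁺ (inj₂ (x∈⁅x⁆ v)) , v∉R
    reached′ : Reached (R ∪ ⁅ v ⁆)
    reached′ {x} x∈R′ with x∈p∪q⁻ R _ x∈R′
    ... | inj₁ x∈R = reached x∈R
    ... | inj₂ x∈v with x∈⁅y⁆⇒x≡y v x∈v
    ...   | refl = snoc (reached w∈R) sv wv
  ... | C , R′⊆C , reachedC , closedC = C , R′⊆C ∘ p⊆p∪q _ , reachedC , closedC

  stays : ∀ {R w v} → Closed R → w ∈ R → WalkIn H S w v → v ∈ R
  stays closed w∈R (here _) = w∈R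
  stays closed w∈R (step _ a p) = stays closed (closed w∈R (wfirst p) a) p

  -- the closure of {u} is exactly the set of vertices reachable from u
  walk? : ∀ v → Dec (WalkIn H S u v)
  walk? v with S u ≟ᵇ true
  ... | no ¬su = no (¬su ∘ wfirst)
  ... | yes su with closure ⁅ u ⁆ (⊃-wellFounded _) start
    where
    start : Reached ⁅ u ⁆
    start x∈u with x∈⁅y⁆⇒x≡y u x∈u
    ... | refl = here su
  ... | C , u⊆C , reached , closed with v ∈? C
  ...   | yes v∈C = yes (reached v∈C)
  ...   | no v∉C = no (v∉C ∘ stays closed (u⊆C (x∈⁅x⁆ u)))

open Reachability using (walk?)

connected? : ∀ {n} (H : Graph n) → Fin n → Disconnected H ⊎ Connected H
connected? H u with any? (λ v → ¬? (walk? H full u v))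
... | yes (v , ¬uv) = inj₁ (u , v , refl , refl , ¬uv)
... | no none = inj₂ ((u , refl) , λ v w _ _ → reverse (reach v) ++ʷ reach w)
  where
  reach : ∀ v → WalkIn H full u v
  reach v with walk? H full u v
  ... | yes p = p
  ... | no ¬p = ⊥-elim (none (v , ¬p))

record CompleteBipartite {n} (G : Graph n) (S : VSet n) : Set where
  field
    left right : VSet n
    left-nonempty  : ∃[ a ] left a ≡ true
    right-nonempty : ∃[ b ] right b ≡ true
    disjoint : ∀ u → ¬ (left u ≡ true × right u ≡ true)
    covers   : ∀ u → S u ≡ (left u ∨ right u)
    complete : ∀ a b → left a ≡ true → right b ≡ true → adj G a b ≡ true

  side : ∀ {u} → S u ≡ true → left u ≡ true ⊎ right u ≡ true
  side {u} su = ∨-true⁻ (left u) (trans (sym (covers u)) su)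

  left⊆ : ∀ {u} → left u ≡ true → S u ≡ true
  left⊆ {u} lu = trans (covers u) (cong (_∨ right u) lu)

  right⊆ : ∀ {u} → right u ≡ true → S u ≡ true
  right⊆ {u} ru = trans (covers u) (trans (cong (left u ∨_) ru) (∨-zeroʳ (left u)))

open CompleteBipartite

module _ {n : ℕ} (G : Graph n) where

  classify : ∀ {S : VSet n} → IsBicliqueVertexSet G S →
    (∃[ w ] (∀ u → S u ≡ true → u ≡ w)) ⊎ CompleteBipartite G S
  classify (inj₁ (w , only , _)) = inj₁ (w , only)
  classify (inj₂ (L , R , l , r , dis , cov , com)) = inj₂ (record
    { left = L ; right = R ; left-nonempty = l ; right-nonempty = r
    ; disjoint = dis ; covers = cov ; complete = com })

  toBiclique : ∀ {S : VSet n} → CompleteBipartite G S → IsBicliqueVertexSet G S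
  toBiclique P =
    inj₂ (left P , right P , left-nonempty P , right-nonempty P , disjoint P , covers P , complete P)

  singleton : (w : Fin n) → IsBicliqueVertexSet G (λ u → does (u ≟ w))
  singleton w = inj₁ (w , (λ u → does-true (u ≟ w)) , dec-true (w ≟ w) refl)

  orient : ∀ {S : VSet n} {x : Fin n} (P : CompleteBipartite G S) → S x ≡ true →
    Σ[ Q ∈ CompleteBipartite G S ] left Q x ≡ true
  orient P sx with side P sx
  ... | inj₁ lx = P , lx
  ... | inj₂ rx = record
    { left = right P ; right = left P
    ; left-nonempty = right-nonempty P ; right-nonempty = left-nonempty P
    ; disjoint = λ u (r , l) → disjoint P u (l , r)
    ; covers = λ u → trans (covers P u) (∨-comm (left P u) (right P u))
    ; complete = λ a b ra lb → trans (adj-sym G a b) (complete P b a lb ra)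
    } , rx

  Ḡ : Graph n
  Ḡ = complement G

  non-edge : ∀ {u w : Fin n} → adj Ḡ u w ≡ true → adj G u w ≡ false
  non-edge {u} {w} p = not-true (adj G u w) (proj₂ (∧-true⁻ (not (does (u ≟ w))) p))

  non-loop : ∀ {u w : Fin n} → adj Ḡ u w ≡ true → u ≢ w
  non-loop {u} {w} p = does-false (u ≟ w) (proj₁ (∧-true⁻ (not (does (u ≟ w))) p))

  Ḡ-edge : ∀ {u w : Fin n} → u ≢ w → adj G u w ≡ false → adj Ḡ u w ≡ true
  Ḡ-edge {u} {w} u≢w p = cong₂ (λ x y → not x ∧ not y) (dec-false (u ≟ w) u≢w) p

  -- Separation: a Ḡ-walk inside (a subset of) a biclique never crosses from the
  -- left side to the right side, since left and right are completely joined in G.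
  module _ {S T : VSet n} (P : CompleteBipartite G T) (S⊆T : ∀ u → S u ≡ true → T u ≡ true) where

    stays-left : ∀ {a v : Fin n} → WalkIn Ḡ S a v → left P a ≡ true → left P v ≡ true
    stays-left (here _) la = la
    stays-left (step {a} {w} _ aw p) la with side P (S⊆T w (wfirst p))
    ... | inj₁ lw = stays-left p lw
    ... | inj₂ rw = ⊥-elim (clash (complete P a w la rw) (non-edge aw))

    separated : ∀ {a b : Fin n} → S a ≡ true → left P a ≡ true → S b ≡ true → right P b ≡ true →
      DisconnectedOn Ḡ S
    separated {a} {b} sa la sb rb = a , b , sa , sb , λ p → disjoint P b (stays-left p la , rb)

    separated-sides : (∀ u → T u ≡ true → S u ≡ true) → DisconnectedOn Ḡ S
    separated-sides T⊆S with left-nonempty P | right-nonempty P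
    ... | a , la | b , rb = separated (T⊆S a (left⊆ P la)) la (T⊆S b (right⊆ P rb)) rb

  component-biclique : ∀ {S : VSet n} → DisconnectedOn Ḡ S → CompleteBipartite G S
  component-biclique {S} (u , v , su , sv , ¬uv) = record
    { left = C ; right = λ w → S w ∧ not (C w)
    ; left-nonempty = u , dec-true (walk? Ḡ S u u) (here su)
    ; right-nonempty = v , cong₂ _∧_ sv (cong not (dec-false (walk? Ḡ S u v) ¬uv))
    ; disjoint = disjoint′ ; covers = covers′ ; complete = complete′ }
    where
    C : VSet n
    C w = does (walk? Ḡ S u w)

    outside : ∀ {w} → S w ∧ not (C w) ≡ true → S w ≡ true × ¬ WalkIn Ḡ S u w
    outside {w} p with ∧-true⁻ (S w) p
    ... | sw , ¬cw = sw , does-false (walk? Ḡ S u w) ¬cw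

    disjoint′ : ∀ w → ¬ (C w ≡ true × S w ∧ not (C w) ≡ true)
    disjoint′ w (cw , rw) = proj₂ (outside rw) (does-true (walk? Ḡ S u w) cw)

    covers′ : ∀ w → S w ≡ (C w ∨ (S w ∧ not (C w)))
    covers′ w = absorb (S w) (C w) (wlast ∘ does-true (walk? Ḡ S u w))

    complete′ : ∀ a b → C a ≡ true → S b ∧ not (C b) ≡ true → adj G a b ≡ true
    complete′ a b ca rb with adj G a b in ab | outside rb
    ... | true  | _ = refl
    ... | false | sb , ¬ub = ⊥-elim (¬ub (snoc ua sb (Ḡ-edge a≢b ab)))
      where
      ua : WalkIn Ḡ S u a
      ua = does-true (walk? Ḡ S u a) ca
      a≢b : a ≢ b
      a≢b refl = ¬ub ua

  biclique-misses-vertex : ∀ {S : VSet n} → Connected Ḡ → CompleteBipartite G S → ∃[ x ] S x ≡ false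
  biclique-misses-vertex {S} (_ , path) P with any? (λ x → S x ≟ᵇ false)
  ... | yes found = found
  ... | no none with separated-sides P everywhere (λ _ _ → refl)
    where
    everywhere : ∀ u → full u ≡ true → S u ≡ true
    everywhere u _ with S u in su
    ... | true  = refl
    ... | false = ⊥-elim (none (u , su))
  ... | a , b , _ , _ , ¬ab = ⊥-elim (¬ab (path a b refl refl))

  -- A vertex adjacent in G to all others is isolated in Ḡ; if Ḡ is connected,
  -- it is therefore the only vertex.
  universal-is-alone : ∀ {d : Fin n} → Connected Ḡ → (∀ q → q ≢ d → adj G q d ≡ true) → ∀ v → v ≡ d
  universal-is-alone {d} (_ , path) universal v with path d v refl refl
  ... | here _ = refl
  ... | step {w = w} _ dw _ =
          ⊥-elim (clash (trans (adj-sym G d w) (universal w (≢-sym (non-loop dw)))) (non-edge dw))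

  -- A cover of V by a single vertex w and a biclique S with two nonempty sides:
  -- S misses some vertex, which must be w, and then Ḡ - w = Ḡ[S] is disconnected.
  singleton-cut : ∀ {S₁ S₂ : VSet n} {w : Fin n} → Connected Ḡ → (∀ u → S₁ u ≡ true → u ≡ w) →
    CompleteBipartite G S₂ → (∀ v → S₁ v ≡ true ⊎ S₂ v ≡ true) → HasCutVertex Ḡ
  singleton-cut {S₁} {S₂} conn only P cover with biclique-misses-vertex conn P
  ... | x , s₂x with only x (other cover s₂x)
  ... | refl = x , separated-sides P rest⊆S₂ S₂⊆rest
    where
    rest⊆S₂ : ∀ u → minus1 x u ≡ true → S₂ u ≡ true
    rest⊆S₂ u u≢x with cover u
    ... | inj₁ s₁u = ⊥-elim (minus1⁻ {w = x} {u} u≢x (only u s₁u))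
    ... | inj₂ s₂u = s₂u
    S₂⊆rest : ∀ u → S₂ u ≡ true → minus1 x u ≡ true
    S₂⊆rest u s₂u = minus1⁺ {w = x} {u} λ { refl → clash s₂u s₂x }

  -- Two bicliques X₁, X₂ covering V, with x ∈ L₁ ∖ X₂, y ∈ L₂ ∖ X₁ and apexes
  -- d ∈ R₁, b ∈ R₂, b ≠ d: then X₂ - d is a disconnected vertex cut of Ḡ, since
  -- V ∖ (X₂ - d) ⊆ X₁ meets L₁ in x and R₁ in d, while X₂ - d meets L₂ in y and R₂ in b.
  apex-cut : ∀ {X₁ X₂ : VSet n} (P₁ : CompleteBipartite G X₁) (P₂ : CompleteBipartite G X₂) →
    (∀ v → X₁ v ≡ true ⊎ X₂ v ≡ true) →
    ∀ {x y d b : Fin n} → left P₁ x ≡ true → X₂ x ≡ false → left P₂ y ≡ true → X₁ y ≡ false →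
    right P₁ d ≡ true → right P₂ b ≡ true → b ≢ d → IsDisconnectedVertexCut Ḡ (X₂ ─ d)
  apex-cut {X₁} {X₂} P₁ P₂ cover {x} {y} {d} {b} lx x₂x ly x₁y rd rb b≢d =
    separated P₁ outside⊆X₁ (∉─⁺ {X = X₂} {d} x₂x) lx (removed {X = X₂} d) rd ,
    separated P₂ inside⊆X₂ (∈─⁺ {X = X₂} (other (⊎-swap ∘ cover) x₁y) y≢d) ly
      (∈─⁺ {X = X₂} (right⊆ P₂ rb) b≢d) rb
    where
    outside⊆X₁ : ∀ u → compl (X₂ ─ d) u ≡ true → X₁ u ≡ true
    outside⊆X₁ u p with ∉─⁻ {X = X₂} p
    ... | inj₁ x₂u = other cover x₂u
    ... | inj₂ refl = right⊆ P₁ rd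
    inside⊆X₂ : ∀ u → (X₂ ─ d) u ≡ true → X₂ u ≡ true
    inside⊆X₂ u p = proj₁ (∧-true⁻ (X₂ u) p)
    y≢d : y ≢ d
    y≢d refl = clash (right⊆ P₁ rd) x₁y

  apexes : ∀ {X₁ X₂ : VSet n} (P₁ : CompleteBipartite G X₁) (P₂ : CompleteBipartite G X₂) →
    (∃[ d ] ∃[ b ] (right P₁ d ≡ true × right P₂ b ≡ true × b ≢ d)) ⊎
    (∃[ d ] ((∀ {u} → right P₁ u ≡ true → u ≡ d) × (∀ {u} → right P₂ u ≡ true → u ≡ d) ×
             right P₁ d ≡ true × right P₂ d ≡ true))
  apexes P₁ P₂ with right-nonempty P₁ | right-nonempty P₂
  ... | d , rd | b₀ , rb₀ with any? (λ b → (right P₂ b ≟ᵇ true) ×-dec ¬? (b ≟ d))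
  ... | yes (b , rb , b≢d) = inj₁ (d , b , rd , rb , b≢d)
  ... | no none₂ with any? (λ e → (right P₁ e ≟ᵇ true) ×-dec ¬? (e ≟ d))
  ...   | yes (e , re , e≢d) = inj₁ (e , b₀ , re , rb₀ , λ b₀≡e → e≢d (trans (sym b₀≡e) (sole none₂ rb₀)))
  ...   | no none₁ = inj₂ (d , sole none₁ , sole none₂ , rd , subst (λ z → right P₂ z ≡ true) (sole none₂ rb₀) rb₀)

  apex-adjacent : ∀ {X : VSet n} {d q : Fin n} (P : CompleteBipartite G X) → (∀ {u} → right P u ≡ true → u ≡ d) →
    right P d ≡ true → X q ≡ true → q ≢ d → adj G q d ≡ true
  apex-adjacent P only rd xq q≢d with side P xq
  ... | inj₁ lq = complete P _ _ lq rd
  ... | inj₂ rq = ⊥-elim (q≢d (only rq))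

  two-bicliques-cut : ∀ {X₁ X₂ : VSet n} → Connected Ḡ →
    CompleteBipartite G X₁ → CompleteBipartite G X₂ → (∀ v → X₁ v ≡ true ⊎ X₂ v ≡ true) →
    HasDisconnectedVertexCut Ḡ
  two-bicliques-cut conn P₁ P₂ cover
    with biclique-misses-vertex conn P₂ | biclique-misses-vertex conn P₁
  ... | x , x₂x | y , x₁y
    with orient P₁ (other cover x₂x) | orient P₂ (other (⊎-swap ∘ cover) x₁y)
  ... | Q₁ , lx | Q₂ , ly with apexes Q₁ Q₂
  ... | inj₁ (d , b , rd , rb , b≢d) = _ , apex-cut Q₁ Q₂ cover lx x₂x ly x₁y rd rb b≢d
  ... | inj₂ (d , only₁ , only₂ , rd₁ , rd₂) = ⊥-elim (disjoint Q₁ d (ld , rd₁))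
    where
    -- the common apex d is adjacent to every other vertex, hence isolated in Ḡ
    universal : ∀ q → q ≢ d → adj G q d ≡ true
    universal q q≢d with cover q
    ... | inj₁ x₁q = apex-adjacent Q₁ only₁ rd₁ x₁q q≢d
    ... | inj₂ x₂q = apex-adjacent Q₂ only₂ rd₂ x₂q q≢d
    -- so d is the only vertex, and x ∈ L₁ is d ∈ R₁
    ld : left Q₁ d ≡ true
    ld = subst (λ z → left Q₁ z ≡ true) (universal-is-alone conn universal x) lx

-- If Ḡ is connected and all vertices of G are among w₁, w₂, then G is K₁ or 2K₁:
-- three vertices cannot fit into two, and an edge of a two-vertex graph G would
-- make its ends isolated in Ḡ.
two-vertices : ∀ {n} (G : Graph n) {w₁ w₂ : Fin n} → Connected (complement G) →
  (∀ u → u ≡ w₁ ⊎ u ≡ w₂) → n ≡ 1 ⊎ (n ≡ 2 × Edgeless G)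
two-vertices {zero} G ((() , _) , _) _
two-vertices {1} G _ _ = inj₁ refl
two-vertices {2} G conn _ = inj₂ (refl , edgeless)
  where
  -- an edge 01 would make 0 universal in G, forcing 1 = 0
  no-edge : adj G zero (suc zero) ≡ false
  no-edge with adj G zero (suc zero) in e
  ... | false = refl
  ... | true = ⊥-elim (0≢1+n (sym (universal-is-alone G conn universal (suc zero))))
    where
    universal : ∀ q → q ≢ zero → adj G q zero ≡ true
    universal zero q≢0 = ⊥-elim (q≢0 refl)
    universal (suc zero) _ = trans (adj-sym G _ _) e
  edgeless : Edgeless G
  edgeless zero zero = adj-irrefl G zero
  edgeless zero (suc zero) = no-edge
  edgeless (suc zero) zero = trans (adj-sym G _ _) no-edge
  edgeless (suc zero) (suc zero) = adj-irrefl G (suc zero)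
two-vertices {suc (suc (suc k))} G _ cover = ⊥-elim (collision (pigeonhole (s≤s (s≤s (s≤s z≤n))) which))
  where
  which : Fin (suc (suc (suc k))) → Fin 2
  which u = [ const zero , const (suc zero) ]′ (cover u)
  coincide : ∀ i j → which i ≡ which j → i ≡ j
  coincide i j _ with cover i | cover j
  coincide i j _ | inj₁ refl | inj₁ refl = refl
  coincide i j _ | inj₂ refl | inj₂ refl = refl
  coincide i j () | inj₁ _ | inj₂ _
  coincide i j () | inj₂ _ | inj₁ _
  collision : ¬ (∃₂ λ i j → i < j × which i ≡ which j)
  collision (i , j , i<j , same) = <-irrefl (coincide i j same) i<j

cover-gives-cut : ∀ {n} (G : Graph n) → Connected (complement G) → BP2 G →
  (n ≡ 1 ⊎ (n ≡ 2 × Edgeless G)) ⊎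
  HasCutVertex (complement G) ⊎ HasDisconnectedVertexCut (complement G)
cover-gives-cut G conn (_ , _ , β₁ , β₂ , cover) with classify G β₁ | classify G β₂
... | inj₁ (_ , only₁) | inj₁ (_ , only₂) = inj₁ (two-vertices G conn λ u → map (only₁ u) (only₂ u) (cover u))
... | inj₁ (_ , only) | inj₂ P = inj₂ (inj₁ (singleton-cut G conn only P cover))
... | inj₂ P | inj₁ (_ , only) = inj₂ (inj₁ (singleton-cut G conn only P (⊎-swap ∘ cover)))
... | inj₂ P₁ | inj₂ P₂ = inj₂ (inj₂ (two-bicliques-cut G conn P₁ P₂ cover))

CutCondition : ∀ {n} → Graph n → Set
CutCondition G =
  Disconnected (complement G)
    ⊎ (Connected (complement G) × HasCutVertex (complement G))
    ⊎ (Connected (complement G) × HasDisconnectedVertexCut (complement G))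

cut-gives-cover : ∀ {n} (G : Graph n) → CutCondition G → BP2 G
cut-gives-cover G (inj₁ disc) = full , full , β , β , λ _ → inj₁ refl
  where β = toBiclique G (component-biclique G disc)
cut-gives-cover G (inj₂ (inj₁ (_ , w , cut))) =
  minus1 w , (λ u → does (u ≟ w)) , toBiclique G (component-biclique G cut) , singleton G w ,
  λ v → ⊎-swap (excluded (does (v ≟ w)))
cut-gives-cover G (inj₂ (inj₂ (_ , X , cut , disc))) =
  X , compl X , toBiclique G (component-biclique G disc) , toBiclique G (component-biclique G cut) ,
  λ v → excluded (X v)

lemma3 : ∀ {n : ℕ} (G : Graph n) → 1 ≤ n → ¬ (n ≡ 1) → ¬ (n ≡ 2 × Edgeless G) →
    (BP2 G ⇔
      (Disconnected (complement G)
       ⊎ (Connected (complement G) × HasCutVertex (complement G))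
       ⊎ (Connected (complement G) × HasDisconnectedVertexCut (complement G))))
lemma3 G 1≤n n≢1 not-2K₁ = mk⇔ forward (cut-gives-cover G)
  where
  forward : BP2 G → CutCondition G
  forward bp with connected? (complement G) (fromℕ< 1≤n)
  ... | inj₁ disc = inj₁ disc
  ... | inj₂ conn with cover-gives-cut G conn bp
  ...   | inj₁ (inj₁ n≡1) = ⊥-elim (n≢1 n≡1)
  ...   | inj₁ (inj₂ 2K₁) = ⊥-elim (not-2K₁ 2K₁)
  ...   | inj₂ (inj₁ cut-vertex) = inj₂ (inj₁ (conn , cut-vertex))
  ...   | inj₂ (inj₂ vertex-cut) = inj₂ (inj₂ (conn , vertex-cut))
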